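{- Let $X$ be a connected $3$-valent Cayley graph on a finite Abelian group. Then $X$ is $2$-spanning cyclable if and only if $X$ is isomorphic to the $3$-dimensional cube $Q_3$ or to $K_2\Box C_n$ for some $n\geq 4$.
   Context: All graphs are finite and simple (no loops or multiple edges). A Cayley graph on an Abelian group $G$ with connection set $S\subseteq G\setminus\{0\}$, $S=-S$, has vertex set $G$, with $g,h$ adjacent iff $h-g\in S$; it is $3$-valent when $|S|=3$. A 2-factor of a graph $X$ is a spanning subgraph in which every vertex has valency $2$. A 2-factor $F$ separates a set $A$ of $k$ vertices if $F$ consists of exactly $k$ cycles and $A$ meets the vertex set of each cycle of $F$ in exactly one vertex. A graph $X$ is $k$-spanning cyclable if for every $A\subseteq V(X)$ with $|A|=k$ there is a 2-factor of $X$ separating $A$. $C_n$ is the cycle of order $n$, $K_2$ the complete graph on two vertices, and $\Box$ the Cartesian product. -}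

module Defs where

open import Level using (0ℓ)
open import Data.Nat using (ℕ; zero; suc; _%_; _≤_)
open import Data.Fin using (Fin; toℕ)
open import Data.Bool using (Bool)
open import Data.Vec using (Vec; lookup)
open import Data.Product using (Σ; ∃; ∃-syntax; _×_; _,_)
open import Data.Sum using (_⊎_)
open import Data.Empty using (⊥)
open import Relation.Nullary using (¬_)
open import Relation.Binary.PropositionalEquality using (_≡_; _≢_)
open import Relation.Binary.Construct.Closure.ReflexiveTransitive using (Star)
open import Function.Bundles using (_↔_; _⇔_; Inverse)
open import Algebra.Core using (Op₁; Op₂)
open import Algebra.Structures using (IsAbelianGroup)

-- Graphs: a vertex type together with an adjacency relation.
-- (Laws such as symmetry / irreflexivity / finiteness are not bundled;
-- the concrete graphs used below are all finite and simple.)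

record Graph : Set₁ where
  constructor mkGraph
  field
    V : Set
    E : V → V → Set
open Graph public

_≅_ : Graph → Graph → Set
X ≅ Y = Σ (V X ↔ V Y) λ f →
  ∀ u v → E X u v ⇔ E Y (Inverse.to f u) (Inverse.to f v)

Connected : Graph → Set
Connected X = ∀ u v → Star (E X) u v

Valency2 : {V : Set} → (V → V → Set) → V → Set
Valency2 F v = ∃[ a ] ∃[ b ] (a ≢ b × F v a × F v b × (∀ c → F v c → c ≡ a ⊎ c ≡ b))

record TwoFactor (X : Graph) : Set₁ where
  field
    F     : V X → V X → Set
    sub   : ∀ u v → F u v → E X u v
    symF  : ∀ u v → F u v → F v u
    val2  : ∀ v → Valency2 F v
open TwoFactor public

-- A 2-factor F separates the 2-set {a , b} (a ≢ b): F has exactly two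
-- cycles (= connected components of F), a and b lying in different ones.
Separates2 : {X : Graph} → TwoFactor X → V X → V X → Set
Separates2 T a b = ¬ Star (F T) a b × (∀ v → Star (F T) a v ⊎ Star (F T) b v)

TwoSpanningCyclable : Graph → Set₁
TwoSpanningCyclable X =
  ∀ a b → a ≢ b → Σ (TwoFactor X) λ T → Separates2 T a b

Cay : (A : Set) → Op₂ A → Op₁ A → (A → Set) → Graph
Cay A _+_ -_ S = mkGraph A (λ g h → S (h + (- g)))

HasSize3 : {A : Set} → (A → Set) → Set
HasSize3 {A} S = ∃[ s₁ ] ∃[ s₂ ] ∃[ s₃ ]
  (s₁ ≢ s₂ × s₁ ≢ s₃ × s₂ ≢ s₃ ×
   (∀ x → S x ⇔ (x ≡ s₁ ⊎ x ≡ s₂ ⊎ x ≡ s₃)))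

Q₃ : Graph
Q₃ = mkGraph (Vec Bool 3) λ u v →
  ∃[ i ] (lookup u i ≢ lookup v i × (∀ j → j ≢ i → lookup u j ≡ lookup v j))

CAdj : (n : ℕ) → Fin n → Fin n → Set
CAdj zero    a b = ⊥
CAdj (suc m) a b = (suc (toℕ a) % suc m ≡ toℕ b) ⊎ (suc (toℕ b) % suc m ≡ toℕ a)

K₂□C : ℕ → Graph
K₂□C n = mkGraph (Fin 2 × Fin n) λ { (i , a) (j , b) →
  (i ≡ j × CAdj n a b) ⊎ (i ≢ j × a ≡ b) }

{-# OPTIONS --safe #-}
-- A 2-factor of a cubic graph is the complement of a perfect matching. In the prism K₂□C n
-- with n ≥ 4, two vertices in the same column are separated by the two layer cycles, and any
-- other pair is, after a rotation, separated by the 4-cycle on columns 0, 1 together with the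
-- cycle through columns 2, …, n − 1; as Q₃ ≅ K₂□C 4 this covers the cube as well.
-- Conversely, inversion permutes S = {s₁, s₂, s₃} and therefore fixes one of its elements.
-- Either every sᵢ is an involution, and the Cayley graph is Q₃, or K₄ when s₃ = s₁ + s₂;
-- or S = {a, −a, b} with 2b = 0, and the graph is K₂□C n for n the order of a, or a Möbius
-- ladder when b ∈ ⟨a⟩. In K₄, in K₂□C 3 and in a Möbius ladder, a 2-factor separating two
-- adjacent vertices cannot use the edge between them, and following the edges this forces
-- at the nearby vertices joins the two vertices after all.

module Submission where

open import Defs
open import Level using (0ℓ)
open import Data.Nat as ℕ
  using (ℕ; zero; suc; _+_; _*_; _∸_; _%_; _/_; _≤_; _<_; z≤n; s≤s; NonZero)
open import Data.Nat.Properties as ℕ using ()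
open import Data.Nat.DivMod using (m%n<n; n%n≡0; m<n⇒m%n≡m; m≡m%n+[m/n]*n)
open import Data.Fin using (Fin; zero; suc; toℕ; fromℕ; fromℕ<; inject₁)
open import Data.Fin.Properties
  using (any?; toℕ-fromℕ<; toℕ-fromℕ; toℕ-inject₁; toℕ-inject; toℕ-injective; toℕ<n; pigeonhole;
         ¬∀⟶∃¬-smallest)
open import Data.Product using (Σ; ∃-syntax; _×_; _,_; proj₁; proj₂)
open import Data.Sum as Sum using (_⊎_; inj₁; inj₂)
open import Data.Empty using (⊥-elim)
open import Relation.Nullary using (¬_; ¬?; yes; no; does)
open import Relation.Nullary.Decidable using (dec-true; dec-false; decidable-stable; via-injection)
open import Data.Bool using (Bool; true; false; not; _xor_; if_then_else_)
open import Data.Bool.Properties using (not-¬; ¬-not; xor-same)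
open import Data.Vec using (Vec; []; _∷_; lookup; zipWith; replicate; _[_]%=_)
open import Data.Vec.Properties
  using (∷-injectiveˡ; ∷-injectiveʳ; lookup∘updateAt; lookup∘updateAt′; tabulate∘lookup; tabulate-cong)
open import Relation.Binary.PropositionalEquality
  using (_≡_; _≢_; refl; sym; trans; cong; cong₂; subst; subst₂; module ≡-Reasoning)
import Relation.Binary.Reasoning.Setoid
open import Relation.Binary.Definitions using (DecidableEquality; tri<; tri≈; tri>)
open import Relation.Binary.Construct.Closure.ReflexiveTransitive
  using (Star; ε; _◅_; _◅◅_; gmap; reverse)
open import Function.Base using (_∘_)
open import Function.Bundles using (_↔_; _⇔_; Inverse; Injection; Equivalence; mk⇔; mk↔ₛ′)
open import Function.Properties.Inverse using (↔⇒↣)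
open import Function.Construct.Composition using (_⇔-∘_)
open import Function.Construct.Identity using (⇔-id)
open import Function.Properties.Equivalence using (⇔-setoid)
open import Algebra.Core using (Op₁; Op₂)
open import Algebra.Structures using (IsAbelianGroup)
open import Algebra.Bundles using (AbelianGroup)
import Algebra.Properties.AbelianGroup as AbelianGroupProperties
import Algebra.Properties.Monoid.Mult as MonoidMultiplication
import Algebra.Properties.CommutativeSemigroup as CommutativeSemigroupProperties

module ⇔-Reasoning = Relation.Binary.Reasoning.Setoid (⇔-setoid 0ℓ)

-- Cubic graphs and their 2-factors

Among : {W : Set} → W → W → W → W → Set
Among x p q r = x ≡ p ⊎ x ≡ q ⊎ x ≡ r

module _ {W : Set} where

  among-rotate : ∀ {x p q r : W} → Among x p q r ⇔ Among x q r p
  among-rotate = mk⇔ rotate (rotate ∘ rotate)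
    where
    rotate : ∀ {x p q r : W} → Among x p q r → Among x q r p
    rotate (inj₁ e)        = inj₂ (inj₂ e)
    rotate (inj₂ (inj₁ e)) = inj₁ e
    rotate (inj₂ (inj₂ e)) = inj₂ (inj₁ e)

  among-swap : ∀ {x p q r : W} → Among x p q r ⇔ Among x q p r
  among-swap = mk⇔ swap swap
    where
    swap : ∀ {x p q r : W} → Among x p q r → Among x q p r
    swap (inj₁ e)        = inj₂ (inj₁ e)
    swap (inj₂ (inj₁ e)) = inj₁ e
    swap (inj₂ (inj₂ e)) = inj₂ (inj₂ e)

  among-cong : ∀ {x p q r p′ q′ r′ : W} → p ≡ p′ → q ≡ q′ → r ≡ r′ →
               Among x p q r ⇔ Among x p′ q′ r′
  among-cong refl refl refl = ⇔-id _

  among-map : ∀ {W′ : Set} {f : W → W′} {x : W} {y : W′} → (∀ t → (x ≡ t) ⇔ (y ≡ f t)) →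
              ∀ {p q r} → Among x p q r ⇔ Among y (f p) (f q) (f r)
  among-map {f = f} x≡⇔y≡ {p} {q} {r} = mk⇔
    (Sum.map (to (x≡⇔y≡ p)) (Sum.map (to (x≡⇔y≡ q)) (to (x≡⇔y≡ r))))
    (Sum.map (from (x≡⇔y≡ p)) (Sum.map (from (x≡⇔y≡ q)) (from (x≡⇔y≡ r))))
    where open Equivalence

  Distinct₃ : W → W → W → Set
  Distinct₃ p q r = p ≢ q × p ≢ r × q ≢ r

  distinct₃-rotate : ∀ {p q r} → Distinct₃ p q r → Distinct₃ q r p
  distinct₃-rotate (p≢q , p≢r , q≢r) = q≢r , (λ e → p≢q (sym e)) , (λ e → p≢r (sym e))

  valency2-avoiding : ∀ {R : W → W → Set} {x p q r} → Valency2 R x →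
                      (∀ c → R x c → Among c p q r) → ¬ R x r → R x p × R x q
  valency2-avoiding {R} {x} (c₁ , c₂ , c₁≢c₂ , Rc₁ , Rc₂ , _) among ¬Rr
    with among c₁ Rc₁ | among c₂ Rc₂
  ... | inj₁ refl        | inj₁ refl        = ⊥-elim (c₁≢c₂ refl)
  ... | inj₁ refl        | inj₂ (inj₁ refl) = Rc₁ , Rc₂
  ... | inj₂ (inj₁ refl) | inj₁ refl        = Rc₂ , Rc₁
  ... | inj₂ (inj₁ refl) | inj₂ (inj₁ refl) = ⊥-elim (c₁≢c₂ refl)
  ... | inj₂ (inj₂ refl) | _                = ⊥-elim (¬Rr Rc₁)
  ... | _                | inj₂ (inj₂ refl) = ⊥-elim (¬Rr Rc₂)

record NeighbourTriple (X : Graph) : Set where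
  field
    nbr₁ nbr₂ nbr₃ : V X → V X
    adjacent⇔ : ∀ u v → E X u v ⇔ Among v (nbr₁ u) (nbr₂ u) (nbr₃ u)

≅-via-neighbours : ∀ {X Y} (NX : NeighbourTriple X) (NY : NeighbourTriple Y) (φ : V X ↔ V Y) →
  (let open NeighbourTriple; to = Inverse.to φ in
   ∀ u w → Among w (to (nbr₁ NX u)) (to (nbr₂ NX u)) (to (nbr₃ NX u))
         ⇔ Among w (nbr₁ NY (to u)) (nbr₂ NY (to u)) (nbr₃ NY (to u))) →
  X ≅ Y
≅-via-neighbours {X} {Y} NX NY φ corresponding = φ , λ u v → begin
  E X u v                                                          ≈⟨ adjacent⇔ NX u v ⟩
  Among v (nbr₁ NX u) (nbr₂ NX u) (nbr₃ NX u)                      ≈⟨ among-map to≡⇔ ⟩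
  Among (to v) (to (nbr₁ NX u)) (to (nbr₂ NX u)) (to (nbr₃ NX u)) ≈⟨ corresponding u (to v) ⟩
  Among (to v) (nbr₁ NY (to u)) (nbr₂ NY (to u)) (nbr₃ NY (to u)) ≈⟨ adjacent⇔ NY (to u) (to v) ⟨
  E Y (to u) (to v)                                                ∎
  where
  open NeighbourTriple
  open ⇔-Reasoning
  to : V X → V Y
  to = Inverse.to φ
  to≡⇔ : ∀ {v} t → (v ≡ t) ⇔ (to v ≡ to t)
  to≡⇔ t = mk⇔ (cong to) (Injection.injective (↔⇒↣ φ))

SeparatingFactor : (X : Graph) → V X → V X → Set₁
SeparatingFactor X a b = Σ (TwoFactor X) λ T → Separates2 T a b

separatingFactor-sym : ∀ {X a b} → SeparatingFactor X a b → SeparatingFactor X b a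
separatingFactor-sym (T , ¬a~b , covered) =
  T , (λ b~a → ¬a~b (reverse (symF T _ _) b~a)) , λ v → Sum.swap (covered v)

module Pullback {X Y : Graph} (φ : X ≅ Y) where
  private
    to : V X → V Y
    to = Inverse.to (proj₁ φ)
    from : V Y → V X
    from = Inverse.from (proj₁ φ)
    to∘from : ∀ y → to (from y) ≡ y
    to∘from = Inverse.strictlyInverseˡ (proj₁ φ)
    from∘to : ∀ x → from (to x) ≡ x
    from∘to = Inverse.strictlyInverseʳ (proj₁ φ)

  pullbackFactor : TwoFactor Y → TwoFactor X
  pullbackFactor T = record
    { F    = λ u v → F T (to u) (to v)
    ; sub  = λ u v f → Equivalence.from (proj₂ φ u v) (sub T _ _ f)
    ; symF = λ u v → symF T _ _
    ; val2 = valency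
    }
    where
    valency : ∀ v → Valency2 (λ u w → F T (to u) (to w)) v
    valency v with val2 T (to v)
    ... | p , q , p≢q , Fp , Fq , only =
      from p , from q , (λ e → p≢q (trans (sym (to∘from p)) (trans (cong to e) (to∘from q)))) ,
      subst (F T (to v)) (sym (to∘from p)) Fp , subst (F T (to v)) (sym (to∘from q)) Fq ,
      λ c Fc → pull (only (to c) Fc)
      where
      pull : ∀ {c} → to c ≡ p ⊎ to c ≡ q → c ≡ from p ⊎ c ≡ from q
      pull {c} (inj₁ e) = inj₁ (trans (sym (from∘to c)) (cong from e))
      pull {c} (inj₂ e) = inj₂ (trans (sym (from∘to c)) (cong from e))

  pullbackWalk : ∀ {T u v} → Star (F T) (to u) (to v) → Star (F (pullbackFactor T)) u v
  pullbackWalk {T} {u} {v} w = subst₂ (Star _) (from∘to u) (from∘to v)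
    (gmap from (λ {x} {y} → subst₂ (F T) (sym (to∘from x)) (sym (to∘from y))) w)

  pullbackSeparating : ∀ {a b} → SeparatingFactor Y (to a) (to b) → SeparatingFactor X a b
  pullbackSeparating (T , ¬a~b , covered) =
    pullbackFactor T , (λ a~b → ¬a~b (gmap to (λ f → f) a~b)) ,
    λ v → Sum.map (pullbackWalk {T}) (pullbackWalk {T}) (covered (to v))

  pullbackCyclable : TwoSpanningCyclable Y → TwoSpanningCyclable X
  pullbackCyclable cyclable a b a≢b =
    pullbackSeparating (cyclable (to a) (to b) (λ e → a≢b (Injection.injective (↔⇒↣ (proj₁ φ)) e)))

module MatchingComplement {X : Graph} (N : NeighbourTriple X)
    (distinct : ∀ u → Distinct₃ (NeighbourTriple.nbr₁ N u) (NeighbourTriple.nbr₂ N u)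
                                (NeighbourTriple.nbr₃ N u))
    (E-sym : ∀ u v → E X u v → E X v u)
    (μ : V X → V X) (μ-adjacent : ∀ u → E X u (μ u)) (μ-involutive : ∀ u → μ (μ u) ≡ u) where
  open NeighbourTriple N

  Unmatched : V X → V X → Set
  Unmatched u v = E X u v × v ≢ μ u

  private
    valency-without : ∀ {u p q r} → (∀ v → E X u v ⇔ Among v p q r) → Distinct₃ p q r →
                      μ u ≡ r → Valency2 Unmatched u
    valency-without {u} {p} {q} {r} adj (p≢q , p≢r , q≢r) refl =
      p , q , p≢q , (Equivalence.from (adj p) (inj₁ refl) , p≢r) ,
      (Equivalence.from (adj q) (inj₂ (inj₁ refl)) , q≢r) , only
      where
      only : ∀ c → Unmatched u c → c ≡ p ⊎ c ≡ q
      only c (Euc , c≢r) with Equivalence.to (adj c) Euc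
      ... | inj₁ e        = inj₁ e
      ... | inj₂ (inj₁ e) = inj₂ e
      ... | inj₂ (inj₂ e) = ⊥-elim (c≢r e)

    rotate : ∀ {u p q r} → (∀ v → E X u v ⇔ Among v p q r) → (∀ v → E X u v ⇔ Among v q r p)
    rotate adj v = among-rotate ⇔-∘ adj v

    valency : ∀ u → Valency2 Unmatched u
    valency u with Equivalence.to (adjacent⇔ u (μ u)) (μ-adjacent u)
    ... | inj₁ e        = valency-without (rotate (adjacent⇔ u)) (distinct₃-rotate (distinct u)) e
    ... | inj₂ (inj₁ e) = valency-without (rotate (rotate (adjacent⇔ u)))
                            (distinct₃-rotate (distinct₃-rotate (distinct u))) e
    ... | inj₂ (inj₂ e) = valency-without (adjacent⇔ u) (distinct u) e

  complementFactor : TwoFactor X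
  complementFactor = record
    { F    = Unmatched
    ; sub  = λ u v → proj₁
    ; symF = λ u v (Euv , v≢μu) →
        E-sym u v Euv , λ u≡μv → v≢μu (trans (sym (μ-involutive v)) (cong μ (sym u≡μv)))
    ; val2 = valency
    }

-- Cycles on Fin (suc n)

module _ {n : ℕ} where

  next : Fin (suc n) → Fin (suc n)
  next x = fromℕ< (m%n<n (suc (toℕ x)) (suc n))

  prev : Fin (suc n) → Fin (suc n)
  prev zero    = fromℕ n
  prev (suc y) = inject₁ y

  toℕ-next : ∀ x → toℕ (next x) ≡ suc (toℕ x) % suc n
  toℕ-next x = toℕ-fromℕ< (m%n<n (suc (toℕ x)) (suc n))

  toℕ-next-< : ∀ x → toℕ x < n → toℕ (next x) ≡ suc (toℕ x)
  toℕ-next-< x x<n = trans (toℕ-next x) (m<n⇒m%n≡m (s≤s x<n))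

  toℕ-next-last : ∀ x → toℕ x ≡ n → toℕ (next x) ≡ 0
  toℕ-next-last x x≡n =
    trans (toℕ-next x) (trans (cong (λ k → suc k % suc n) x≡n) (n%n≡0 (suc n)))

  toℕ-prev-zero : ∀ x → toℕ x ≡ 0 → toℕ (prev x) ≡ n
  toℕ-prev-zero zero _ = toℕ-fromℕ n

  toℕ-prev-suc : ∀ x {k} → toℕ x ≡ suc k → toℕ (prev x) ≡ k
  toℕ-prev-suc (suc y) e = trans (toℕ-inject₁ y) (ℕ.suc-injective e)

  next-prev : ∀ x → next (prev x) ≡ x
  next-prev zero    = toℕ-injective (toℕ-next-last (fromℕ n) (toℕ-fromℕ n))
  next-prev (suc y) =
    toℕ-injective (trans (toℕ-next-< (inject₁ y) inject₁y<n) (cong suc (toℕ-inject₁ y)))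
    where
    inject₁y<n : toℕ (inject₁ y) < n
    inject₁y<n = subst (_< n) (sym (toℕ-inject₁ y)) (toℕ<n y)

  prev-next : ∀ x → prev (next x) ≡ x
  prev-next x with ℕ.m<1+n⇒m<n∨m≡n (toℕ<n x)
  ... | inj₁ x<n = toℕ-injective (toℕ-prev-suc (next x) (toℕ-next-< x x<n))
  ... | inj₂ x≡n = toℕ-injective (trans (toℕ-prev-zero (next x) (toℕ-next-last x x≡n)) (sym x≡n))

  next≡⇒≡prev : ∀ {x y} → next y ≡ x → y ≡ prev x
  next≡⇒≡prev {x} {y} e = trans (sym (prev-next y)) (cong prev e)

  CAdj⇔ : ∀ x y → CAdj (suc n) x y ⇔ (y ≡ next x ⊎ y ≡ prev x)
  CAdj⇔ x y = mk⇔ to from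
    where
    to : CAdj (suc n) x y → y ≡ next x ⊎ y ≡ prev x
    to (inj₁ e) = inj₁ (toℕ-injective (sym (trans (toℕ-next x) e)))
    to (inj₂ e) = inj₂ (next≡⇒≡prev (toℕ-injective (trans (toℕ-next y) e)))
    from : y ≡ next x ⊎ y ≡ prev x → CAdj (suc n) x y
    from (inj₁ refl) = inj₁ (sym (toℕ-next x))
    from (inj₂ refl) = inj₂ (trans (sym (toℕ-next (prev x))) (cong toℕ (next-prev x)))

-- The prism K₂□C n

flip : Fin 2 → Fin 2
flip zero       = suc zero
flip (suc zero) = zero

flip-involutive : ∀ i → flip (flip i) ≡ i
flip-involutive zero       = refl
flip-involutive (suc zero) = refl

≢flip : ∀ i → i ≢ flip i
≢flip zero       ()
≢flip (suc zero) ()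

≢⇒≡flip : ∀ {i j} → i ≢ j → j ≡ flip i
≢⇒≡flip {zero}     {zero}     i≢j = ⊥-elim (i≢j refl)
≢⇒≡flip {zero}     {suc zero} _   = refl
≢⇒≡flip {suc zero} {zero}     _   = refl
≢⇒≡flip {suc zero} {suc zero} i≢j = ⊥-elim (i≢j refl)

fin2-covered : ∀ {i j} → i ≢ j → ∀ k → k ≡ i ⊎ k ≡ j
fin2-covered {i} i≢j k with k Data.Fin.≟ i
... | yes k≡i = inj₁ k≡i
... | no k≢i  = inj₂ (trans (≢⇒≡flip (λ e → k≢i (sym e))) (sym (≢⇒≡flip i≢j)))

module Prism (n : ℕ) where

  K : Graph
  K = K₂□C (suc n)

  Vertex : Set
  Vertex = Fin 2 × Fin (suc n)

  right left across : Vertex → Vertex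
  right  (i , x) = i , next x
  left   (i , x) = i , prev x
  across (i , x) = flip i , x

  prism-adjacent⇔ : ∀ c d → E K c d ⇔ Among d (right c) (left c) (across c)
  prism-adjacent⇔ (i , x) (j , y) = mk⇔ to from
    where
    to : E K (i , x) (j , y) → Among (j , y) (right (i , x)) (left (i , x)) (across (i , x))
    to (inj₁ (refl , x~y)) with Equivalence.to (CAdj⇔ x y) x~y
    ... | inj₁ refl = inj₁ refl
    ... | inj₂ refl = inj₂ (inj₁ refl)
    to (inj₂ (i≢j , refl)) rewrite ≢⇒≡flip i≢j = inj₂ (inj₂ refl)
    from : Among (j , y) (right (i , x)) (left (i , x)) (across (i , x)) → E K (i , x) (j , y)
    from (inj₁ refl)        = inj₁ (refl , Equivalence.from (CAdj⇔ x y) (inj₁ refl))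
    from (inj₂ (inj₁ refl)) = inj₁ (refl , Equivalence.from (CAdj⇔ x y) (inj₂ refl))
    from (inj₂ (inj₂ refl)) = inj₂ (≢flip i , refl)

  prismNeighbours : NeighbourTriple K
  prismNeighbours = record
    { nbr₁ = right ; nbr₂ = left ; nbr₃ = across ; adjacent⇔ = prism-adjacent⇔ }

  prism-sym : ∀ c d → E K c d → E K d c
  prism-sym _ _ (inj₁ (refl , inj₁ e)) = inj₁ (refl , inj₂ e)
  prism-sym _ _ (inj₁ (refl , inj₂ e)) = inj₁ (refl , inj₁ e)
  prism-sym _ _ (inj₂ (i≢j , refl))    = inj₂ ((λ e → i≢j (sym e)) , refl)

  adjacent-right : ∀ c → E K c (right c)
  adjacent-right c = Equivalence.from (prism-adjacent⇔ c (right c)) (inj₁ refl)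

  adjacent-left : ∀ c → E K c (left c)
  adjacent-left c = Equivalence.from (prism-adjacent⇔ c (left c)) (inj₂ (inj₁ refl))

  adjacent-across : ∀ c → E K c (across c)
  adjacent-across c = Equivalence.from (prism-adjacent⇔ c (across c)) (inj₂ (inj₂ refl))

  left-right : ∀ c → left (right c) ≡ c
  left-right (i , x) = cong (i ,_) (prev-next x)

  right-left : ∀ c → right (left c) ≡ c
  right-left (i , x) = cong (i ,_) (next-prev x)

  across-involutive : ∀ c → across (across c) ≡ c
  across-involutive (i , x) = cong (_, x) (flip-involutive i)

  left-injective : ∀ {c d} → left c ≡ left d → c ≡ d
  left-injective {c} {d} e = trans (sym (right-left c)) (trans (cong right e) (right-left d))

  ≢across : ∀ {c d} → proj₁ d ≡ proj₁ c → d ≢ across c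
  ≢across {i , _} refl e = ≢flip i (cong proj₁ e)

  leftRotation : K ≅ K
  leftRotation = mk↔ₛ′ left right left-right right-left , λ c d → mk⇔ (to c d) (from c d)
    where
    to : ∀ c d → E K c d → E K (left c) (left d)
    to c d Ecd with Equivalence.to (prism-adjacent⇔ c d) Ecd
    ... | inj₁ refl        =
      subst (E K (left c)) (sym (left-right c)) (prism-sym _ _ (adjacent-left c))
    ... | inj₂ (inj₁ refl) = adjacent-left (left c)
    ... | inj₂ (inj₂ refl) = adjacent-across (left c)
    from : ∀ c d → E K (left c) (left d) → E K c d
    from c d Ecd with Equivalence.to (prism-adjacent⇔ (left c) (left d)) Ecd
    ... | inj₁ e        = subst (E K c)
      (sym (left-injective (trans e (trans (right-left c) (sym (left-right c)))))) (adjacent-right c)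
    ... | inj₂ (inj₁ e) = subst (E K c) (sym (left-injective e)) (adjacent-left c)
    ... | inj₂ (inj₂ e) = subst (E K c) (sym (left-injective e)) (adjacent-across c)

  cyclable-from-column0 : (∀ i b → (i , zero) ≢ b → SeparatingFactor K (i , zero) b) →
                          TwoSpanningCyclable K
  cyclable-from-column0 separate (i , x) b a≢b = go (toℕ x) refl b a≢b
    where
    go : ∀ t {x} → toℕ x ≡ t → ∀ b → (i , x) ≢ b → SeparatingFactor K (i , x) b
    go zero    {x} x≡0 b a≢b with toℕ-injective {i = x} {j = zero} x≡0
    ... | refl = separate i b a≢b
    go (suc t) {x} x≡1+t b a≢b = Pullback.pullbackSeparating leftRotation
      (go t (toℕ-prev-suc x x≡1+t) (left b) (λ e → a≢b (left-injective e)))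

next≢prev : ∀ {m} (x : Fin (3 + m)) → next x ≢ prev x
next≢prev {m} x next≡prev with x | ℕ.m<1+n⇒m<n∨m≡n (toℕ<n x)
... | zero  | _ = 1≢2+m
  (trans (sym (toℕ-next-< {2 + m} zero (s≤s z≤n))) (trans (cong toℕ next≡prev) (toℕ-fromℕ (2 + m))))
  where
  1≢2+m : 1 ≢ 2 + m
  1≢2+m ()
... | suc y | inj₁ x<2+m = ℕ.m≢1+n+m (toℕ y)
  (sym (trans (sym (toℕ-next-< (suc y) x<2+m)) (trans (cong toℕ next≡prev) (toℕ-inject₁ y))))
... | suc y | inj₂ x≡2+m = 0≢1+m
  (trans (sym (toℕ-next-last (suc y) x≡2+m)) (trans (cong toℕ next≡prev) (toℕ-prev-suc (suc y) x≡2+m)))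
  where
  0≢1+m : 0 ≢ 1 + m
  0≢1+m ()

module Layers (m : ℕ) where
  open Prism (2 + m)

  prism-distinct : ∀ c → Distinct₃ (right c) (left c) (across c)
  prism-distinct (i , x) = (λ e → next≢prev x (cong proj₂ e)) , ≢across refl , ≢across refl

  open MatchingComplement prismNeighbours prism-distinct prism-sym
         across adjacent-across across-involutive
    renaming (complementFactor to layersFactor)

  layer-preserved : ∀ {c d} → Star Unmatched c d → proj₁ c ≡ proj₁ d
  layer-preserved ε = refl
  layer-preserved {c} (_◅_ {j = d} (Ecd , d≢across) w)
    with Equivalence.to (prism-adjacent⇔ c d) Ecd
  ... | inj₁ refl        = layer-preserved w
  ... | inj₂ (inj₁ refl) = layer-preserved w
  ... | inj₂ (inj₂ refl) = ⊥-elim (d≢across refl)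

  walk-to-column0 : ∀ t i {x} → toℕ x ≡ t → Star Unmatched (i , x) (i , zero)
  walk-to-column0 zero    i {x} x≡0 with toℕ-injective {i = x} {j = zero} x≡0
  ... | refl = ε
  walk-to-column0 (suc t) i {x} x≡1+t =
    (adjacent-left (i , x) , ≢across refl) ◅ walk-to-column0 t i (toℕ-prev-suc x x≡1+t)

  walk-in-layer : ∀ i x y → Star Unmatched (i , x) (i , y)
  walk-in-layer i x y = walk-to-column0 (toℕ x) i refl ◅◅
    reverse (symF layersFactor _ _) (walk-to-column0 (toℕ y) i refl)

  layersSeparate : ∀ {i j} x y → i ≢ j → SeparatingFactor K (i , x) (j , y)
  layersSeparate {i} {j} x y i≢j = layersFactor , (λ w → i≢j (layer-preserved w)) , covered
    where
    covered : ∀ v → Star Unmatched (i , x) v ⊎ Star Unmatched (j , y) v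
    covered (k , z) with fin2-covered i≢j k
    ... | inj₁ refl = inj₁ (walk-in-layer k x z)
    ... | inj₂ refl = inj₂ (walk-in-layer k y z)

data Column (m k : ℕ) : Set where
  first  : k ≡ 0 → Column m k
  second : k ≡ 1 → Column m k
  third  : k ≡ 2 → Column m k
  inner  : ∀ j → k ≡ 3 + j → j < m → Column m k
  final  : k ≡ 3 + m → Column m k

column : ∀ m k → k < 4 + m → Column m k
column m 0 _ = first refl
column m 1 _ = second refl
column m 2 _ = third refl
column m (suc (suc (suc j))) (s≤s (s≤s (s≤s (s≤s j≤m)))) with ℕ.m≤n⇒m<n∨m≡n j≤m
... | inj₁ j<m = inner j refl j<m
... | inj₂ refl = final refl

module Square (m : ℕ) where
  open Prism (3 + m)
  open Layers (suc m) using (prism-distinct; layersSeparate)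

  columnOf : (x : Fin (4 + m)) → Column m (toℕ x)
  columnOf x = column m (toℕ x) (toℕ<n x)

  -- The edges left out by the 4-cycle on columns 0, 1 and the cycle through columns 2, …, 3 + m:
  -- the rim edges 1–2 and (3 + m)–0, and the rungs of the inner columns 3, …, 2 + m.
  partner : ℕ → Vertex → Vertex
  partner 0                   = left
  partner 1                   = right
  partner 2                   = left
  partner (suc (suc (suc j))) = if does (j ℕ.<? m) then across else right

  squareMatch : Vertex → Vertex
  squareMatch (i , x) = partner (toℕ x) (i , x)

  match-left : ∀ {i x} → toℕ x ≡ 0 ⊎ toℕ x ≡ 2 → squareMatch (i , x) ≡ left (i , x)
  match-left {i} {x} (inj₁ x≡0) = cong (λ k → partner k (i , x)) x≡0
  match-left {i} {x} (inj₂ x≡2) = cong (λ k → partner k (i , x)) x≡2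

  match-right : ∀ {i x} → toℕ x ≡ 1 ⊎ toℕ x ≡ 3 + m → squareMatch (i , x) ≡ right (i , x)
  match-right {i} {x} (inj₁ x≡1) = cong (λ k → partner k (i , x)) x≡1
  match-right {i} {x} (inj₂ x≡3+m) = trans (cong (λ k → partner k (i , x)) x≡3+m)
    (cong (λ b → (if b then across else right) (i , x)) (dec-false (m ℕ.<? m) (ℕ.n≮n m)))

  match-across : ∀ {i x j} → toℕ x ≡ 3 + j → j < m → squareMatch (i , x) ≡ across (i , x)
  match-across {i} {x} {j} x≡3+j j<m = trans (cong (λ k → partner k (i , x)) x≡3+j)
    (cong (λ b → (if b then across else right) (i , x)) (dec-true (j ℕ.<? m) j<m))

  squareMatch-adjacent : ∀ c → E K c (squareMatch c)
  squareMatch-adjacent (i , x) with columnOf x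
  ... | first h       = subst (E K _) (sym (match-left (inj₁ h))) (adjacent-left _)
  ... | second h      = subst (E K _) (sym (match-right (inj₁ h))) (adjacent-right _)
  ... | third h       = subst (E K _) (sym (match-left (inj₂ h))) (adjacent-left _)
  ... | inner _ h j<m = subst (E K _) (sym (match-across h j<m)) (adjacent-across _)
  ... | final h       = subst (E K _) (sym (match-right (inj₂ h))) (adjacent-right _)

  squareMatch-involutive : ∀ c → squareMatch (squareMatch c) ≡ c
  squareMatch-involutive (i , x) with columnOf x
  ... | first h = trans (cong squareMatch (match-left (inj₁ h)))
                    (trans (match-right (inj₂ (toℕ-prev-zero x h))) (right-left _))
  ... | second h = trans (cong squareMatch (match-right (inj₁ h)))
                     (trans (match-left (inj₂ (trans (toℕ-next-< x x<3+m) (cong suc h)))) (left-right _))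
    where
    x<3+m : toℕ x < 3 + m
    x<3+m = subst (_< 3 + m) (sym h) (s≤s (s≤s z≤n))
  ... | third h = trans (cong squareMatch (match-left (inj₂ h)))
                    (trans (match-right (inj₁ (toℕ-prev-suc x h))) (right-left _))
  ... | inner _ h j<m = trans (cong squareMatch (match-across h j<m))
                          (trans (match-across h j<m) (across-involutive _))
  ... | final h = trans (cong squareMatch (match-right (inj₂ h)))
                    (trans (match-left (inj₁ (toℕ-next-last x h))) (left-right _))

  open MatchingComplement prismNeighbours prism-distinct prism-sym
         squareMatch squareMatch-adjacent squareMatch-involutive
    renaming (complementFactor to squareFactor)

  Low : Vertex → Set
  Low (_ , x) = toℕ x ≤ 1

  left≢right : ∀ c → left c ≢ right c
  left≢right (_ , x) e = next≢prev x (sym (cong proj₂ e))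

  across≢left : ∀ c → across c ≢ left c
  across≢left c e = ≢across refl (sym e)

  left≢squareMatch : ∀ {i x t} → toℕ x ≡ 3 + t → left (i , x) ≢ squareMatch (i , x)
  left≢squareMatch {i} {x} x≡3+t with columnOf x
  ... | first h with trans (sym x≡3+t) h
  ...   | ()
  left≢squareMatch {i} {x} x≡3+t | second h with trans (sym x≡3+t) h
  ...   | ()
  left≢squareMatch {i} {x} x≡3+t | third h with trans (sym x≡3+t) h
  ...   | ()
  left≢squareMatch {i} {x} x≡3+t | inner _ h j<m = λ e → ≢across refl (trans e (match-across h j<m))
  left≢squareMatch {i} {x} x≡3+t | final h = λ e → left≢right (i , x) (trans e (match-right (inj₂ h)))

  low-closed : ∀ {c d} → Unmatched c d → Low c → Low d
  low-closed {i , x} {d} (Ecd , d≢μc) x≤1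
    with Equivalence.to (prism-adjacent⇔ (i , x) d) Ecd | ℕ.n≤1⇒n≡0∨n≡1 x≤1
  ... | inj₁ refl        | inj₁ x≡0 =
    ℕ.≤-reflexive (trans (toℕ-next-< x (ℕ.≤-trans (s≤s x≤1) (s≤s (s≤s z≤n)))) (cong suc x≡0))
  ... | inj₁ refl        | inj₂ x≡1 = ⊥-elim (d≢μc (sym (match-right (inj₁ x≡1))))
  ... | inj₂ (inj₁ refl) | inj₁ x≡0 = ⊥-elim (d≢μc (sym (match-left (inj₁ x≡0))))
  ... | inj₂ (inj₁ refl) | inj₂ x≡1 = subst (_≤ 1) (sym (toℕ-prev-suc x x≡1)) z≤n
  ... | inj₂ (inj₂ refl) | _        = x≤1

  low-closed⋆ : ∀ {c d} → Star Unmatched c d → Low c → Low d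
  low-closed⋆ ε         low = low
  low-closed⋆ (f ◅ w) low = low-closed⋆ w (low-closed f low)

  walk-to-corner : ∀ i {x} → toℕ x ≡ 0 → Star Unmatched (i , x) (zero , zero)
  walk-to-corner i {x} x≡0 with toℕ-injective {i = x} {j = zero} x≡0
  walk-to-corner zero       _   | refl = ε
  walk-to-corner (suc zero) x≡0 | refl =
    (adjacent-across _ , λ e → across≢left _ (trans e (match-left (inj₁ x≡0)))) ◅ ε

  walk-low : ∀ c → Low c → Star Unmatched c (zero , zero)
  walk-low (i , x) x≤1 with ℕ.n≤1⇒n≡0∨n≡1 x≤1
  ... | inj₁ x≡0 = walk-to-corner i x≡0
  ... | inj₂ x≡1 = (adjacent-left _ , λ e → left≢right (i , x) (trans e (match-right (inj₁ x≡1)))) ◅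
                   walk-to-corner i (toℕ-prev-suc x x≡1)

  walk-high : ∀ t {i x} → toℕ x ≡ t → 2 ≤ t → Star Unmatched (i , x) (zero , suc (suc zero))
  walk-high 0 _ ()
  walk-high 1 _ (s≤s ())
  walk-high 2 {i} {x} x≡2 _ with toℕ-injective {i = x} {j = suc (suc zero)} x≡2
  walk-high 2 {zero}     _   _ | refl = ε
  walk-high 2 {suc zero} x≡2 _ | refl =
    (adjacent-across _ , λ e → across≢left _ (trans e (match-left (inj₂ x≡2)))) ◅ ε
  walk-high (suc (suc (suc t))) {i} {x} x≡3+t _ =
    (adjacent-left _ , left≢squareMatch x≡3+t) ◅
    walk-high (suc (suc t)) (toℕ-prev-suc x x≡3+t) (s≤s (s≤s z≤n))

  squareSeparate : ∀ {a b} → Low a → 2 ≤ toℕ (proj₂ b) → SeparatingFactor K a b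
  squareSeparate {a} {j , y} low-a high-b =
    squareFactor , (λ w → ℕ.<-irrefl refl (ℕ.≤-trans high-b (low-closed⋆ w low-a))) , covered
    where
    covered : ∀ v → Star Unmatched a v ⊎ Star Unmatched (j , y) v
    covered (k , z) with toℕ z ℕ.≤? 1
    ... | yes low-v = inj₁ (walk-low a low-a ◅◅ reverse (symF squareFactor _ _) (walk-low _ low-v))
    ... | no ¬low-v = inj₂ (walk-high (toℕ y) refl high-b ◅◅
                            reverse (symF squareFactor _ _) (walk-high (toℕ z) refl (ℕ.≰⇒> ¬low-v)))

  separate-from-column0 : ∀ i b → (i , zero) ≢ b → SeparatingFactor K (i , zero) b
  separate-from-column0 i (j , y) a≢b with columnOf y
  ... | first h with toℕ-injective {i = y} {j = zero} h
  ...   | refl = layersSeparate zero zero (λ i≡j → a≢b (cong (_, zero) i≡j))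
  separate-from-column0 i (j , y) a≢b | second h = Pullback.pullbackSeparating leftRotation
    (separatingFactor-sym (squareSeparate (subst (_≤ 1) (sym (toℕ-prev-suc y h)) z≤n)
                                          (subst (2 ≤_) (sym (toℕ-fromℕ (3 + m))) (s≤s (s≤s z≤n)))))
  separate-from-column0 i (j , y) a≢b | third h     = squareSeparate z≤n (ℕ.≤-reflexive (sym h))
  separate-from-column0 i (j , y) a≢b | inner _ h _ =
    squareSeparate z≤n (subst (2 ≤_) (sym h) (s≤s (s≤s z≤n)))
  separate-from-column0 i (j , y) a≢b | final h =
    squareSeparate z≤n (subst (2 ≤_) (sym h) (s≤s (s≤s z≤n)))

  prism-cyclable : TwoSpanningCyclable (K₂□C (4 + m))
  prism-cyclable = cyclable-from-column0 separate-from-column0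

-- The cube Q₃

xor≡false⇒≡ : ∀ {n} (u v : Vec Bool n) → zipWith _xor_ u v ≡ replicate n false → u ≡ v
xor≡false⇒≡ []      []      _ = refl
xor≡false⇒≡ (x ∷ u) (y ∷ v) e = cong₂ _∷_ (head≡ x y (∷-injectiveˡ e)) (xor≡false⇒≡ u v (∷-injectiveʳ e))
  where
  head≡ : ∀ x y → x xor y ≡ false → x ≡ y
  head≡ false false _ = refl
  head≡ true  true  _ = refl

toggle : Fin 3 → Vec Bool 3 → Vec Bool 3
toggle i u = u [ i ]%= not

Q₃-adjacent-toggle : ∀ u i → E Q₃ u (toggle i u)
Q₃-adjacent-toggle u i =
  i , (λ e → not-¬ refl (trans e (lookup∘updateAt i u))) , λ j j≢i → sym (lookup∘updateAt′ j i j≢i u)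

Q₃-adjacent⇒toggle : ∀ u v → E Q₃ u v → ∃[ i ] v ≡ toggle i u
Q₃-adjacent⇒toggle u v (i , uᵢ≢vᵢ , same) = i , vec-ext pointwise
  where
  vec-ext : ∀ {w} → (∀ j → lookup v j ≡ lookup w j) → v ≡ w
  vec-ext {w} p = trans (sym (tabulate∘lookup v)) (trans (tabulate-cong p) (tabulate∘lookup w))
  pointwise : ∀ j → lookup v j ≡ lookup (toggle i u) j
  pointwise j with j Data.Fin.≟ i
  ... | yes refl = trans (¬-not (λ e → uᵢ≢vᵢ (sym e))) (sym (lookup∘updateAt j u))
  ... | no j≢i   = trans (sym (same j j≢i)) (sym (lookup∘updateAt′ j i j≢i u))

cubeNeighbours : NeighbourTriple Q₃
cubeNeighbours = record
  { nbr₁ = toggle zero ; nbr₂ = toggle (suc zero) ; nbr₃ = toggle (suc (suc zero))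
  ; adjacent⇔ = λ u v → mk⇔ (to u v) (from u v)
  }
  where
  to : ∀ u v → E Q₃ u v → Among v (toggle zero u) (toggle (suc zero) u) (toggle (suc (suc zero)) u)
  to u v Euv with Q₃-adjacent⇒toggle u v Euv
  ... | zero             , e = inj₁ e
  ... | suc zero         , e = inj₂ (inj₁ e)
  ... | suc (suc zero)   , e = inj₂ (inj₂ e)
  from : ∀ u v → Among v (toggle zero u) (toggle (suc zero) u) (toggle (suc (suc zero)) u) → E Q₃ u v
  from u _ (inj₁ refl)        = Q₃-adjacent-toggle u zero
  from u _ (inj₂ (inj₁ refl)) = Q₃-adjacent-toggle u (suc zero)
  from u _ (inj₂ (inj₂ refl)) = Q₃-adjacent-toggle u (suc (suc zero))

module CubeAsPrism where
  open Prism 3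

  bit : Bool → Fin 2
  bit false = zero
  bit true  = suc zero

  gray : Bool → Bool → Fin 4
  gray false false = zero
  gray true  false = suc zero
  gray true  true  = suc (suc zero)
  gray false true  = suc (suc (suc zero))

  cubeToPrism : Vec Bool 3 → Vertex
  cubeToPrism (x ∷ y ∷ z ∷ []) = bit z , gray x y

  unbit : Fin 2 → Bool
  unbit zero       = false
  unbit (suc zero) = true

  ungray₁ ungray₂ : Fin 4 → Bool
  ungray₁ zero                   = false
  ungray₁ (suc zero)             = true
  ungray₁ (suc (suc zero))       = true
  ungray₁ (suc (suc (suc zero))) = false
  ungray₂ zero                   = false
  ungray₂ (suc zero)             = false
  ungray₂ (suc (suc zero))       = true
  ungray₂ (suc (suc (suc zero))) = true

  prismToCube : Vertex → Vec Bool 3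
  prismToCube (i , c) = ungray₁ c ∷ ungray₂ c ∷ unbit i ∷ []

  cubeToPrism∘prismToCube : ∀ c → cubeToPrism (prismToCube c) ≡ c
  cubeToPrism∘prismToCube (zero     , zero)                   = refl
  cubeToPrism∘prismToCube (zero     , suc zero)               = refl
  cubeToPrism∘prismToCube (zero     , suc (suc zero))         = refl
  cubeToPrism∘prismToCube (zero     , suc (suc (suc zero)))   = refl
  cubeToPrism∘prismToCube (suc zero , zero)                   = refl
  cubeToPrism∘prismToCube (suc zero , suc zero)               = refl
  cubeToPrism∘prismToCube (suc zero , suc (suc zero))         = refl
  cubeToPrism∘prismToCube (suc zero , suc (suc (suc zero)))   = refl

  prismToCube∘cubeToPrism : ∀ u → prismToCube (cubeToPrism u) ≡ u
  prismToCube∘cubeToPrism (false ∷ false ∷ false ∷ []) = refl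
  prismToCube∘cubeToPrism (false ∷ false ∷ true  ∷ []) = refl
  prismToCube∘cubeToPrism (false ∷ true  ∷ false ∷ []) = refl
  prismToCube∘cubeToPrism (false ∷ true  ∷ true  ∷ []) = refl
  prismToCube∘cubeToPrism (true  ∷ false ∷ false ∷ []) = refl
  prismToCube∘cubeToPrism (true  ∷ false ∷ true  ∷ []) = refl
  prismToCube∘cubeToPrism (true  ∷ true  ∷ false ∷ []) = refl
  prismToCube∘cubeToPrism (true  ∷ true  ∷ true  ∷ []) = refl

  toggles-correspond : ∀ u w →
    let c = cubeToPrism u in
    Among w (cubeToPrism (toggle zero u)) (cubeToPrism (toggle (suc zero) u))
            (cubeToPrism (toggle (suc (suc zero)) u))
    ⇔ Among w (right c) (left c) (across c)
  toggles-correspond (false ∷ false ∷ false ∷ []) w = ⇔-id _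
  toggles-correspond (false ∷ false ∷ true  ∷ []) w = ⇔-id _
  toggles-correspond (false ∷ true  ∷ false ∷ []) w = among-swap
  toggles-correspond (false ∷ true  ∷ true  ∷ []) w = among-swap
  toggles-correspond (true  ∷ false ∷ false ∷ []) w = among-swap
  toggles-correspond (true  ∷ false ∷ true  ∷ []) w = among-swap
  toggles-correspond (true  ∷ true  ∷ false ∷ []) w = ⇔-id _
  toggles-correspond (true  ∷ true  ∷ true  ∷ []) w = ⇔-id _

  Q₃≅prism : Q₃ ≅ K₂□C 4
  Q₃≅prism = ≅-via-neighbours cubeNeighbours prismNeighbours
    (mk↔ₛ′ cubeToPrism prismToCube cubeToPrism∘prismToCube prismToCube∘cubeToPrism)
    toggles-correspond

Q₃-cyclable : TwoSpanningCyclable Q₃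
Q₃-cyclable = Pullback.pullbackCyclable CubeAsPrism.Q₃≅prism (Square.prism-cyclable 0)

-- Cubic Cayley graphs on Abelian groups

module Cayley (A : Set) (_+_ : Op₂ A) (0# : A) (-_ : Op₁ A)
              (isAbelianGroup : IsAbelianGroup _≡_ _+_ 0# -_) where

  -- From here on the group is written multiplicatively, as in the library's group bundles.
  G : AbelianGroup 0ℓ 0ℓ
  G = record { isAbelianGroup = isAbelianGroup }

  open AbelianGroup G using (_∙_; _⁻¹; assoc; comm; identityˡ; identityʳ; inverseʳ)
  open AbelianGroupProperties G
    using (⁻¹-involutive; xyx⁻¹≈y; //-rightDividesˡ; //-rightDividesʳ; inverseʳ-unique; ∙-cancelˡ)
  open CommutativeSemigroupProperties (AbelianGroup.commutativeSemigroup G)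
    using (interchange; xy∙z≈xz∙y)
  open MonoidMultiplication (AbelianGroup.monoid G) using (×-homo-+) renaming (_×_ to infixr 8 _·_)

  Cay⟨_⟩ : (A → Set) → Graph
  Cay⟨ S ⟩ = Cay A _∙_ _⁻¹ S

  EnumeratedBy : (A → Set) → A → A → A → Set
  EnumeratedBy S t₁ t₂ t₃ = ∀ x → S x ⇔ Among x t₁ t₂ t₃

  enumeratedBy-rotate : ∀ {S t₁ t₂ t₃} → EnumeratedBy S t₁ t₂ t₃ → EnumeratedBy S t₂ t₃ t₁
  enumeratedBy-rotate S≐ x = among-rotate ⇔-∘ S≐ x

  difference≡⇔ : ∀ g h t → (h ∙ g ⁻¹ ≡ t) ⇔ (h ≡ g ∙ t)
  difference≡⇔ g h t = mk⇔ to from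
    where
    to : h ∙ g ⁻¹ ≡ t → h ≡ g ∙ t
    to refl = trans (sym (//-rightDividesˡ g h)) (comm _ g)
    from : h ≡ g ∙ t → h ∙ g ⁻¹ ≡ t
    from refl = xyx⁻¹≈y g t

  cayleyNeighbours : ∀ {S t₁ t₂ t₃} → EnumeratedBy S t₁ t₂ t₃ → NeighbourTriple Cay⟨ S ⟩
  cayleyNeighbours {t₁ = t₁} {t₂} {t₃} S≐ = record
    { nbr₁ = _∙ t₁ ; nbr₂ = _∙ t₂ ; nbr₃ = _∙ t₃
    ; adjacent⇔ = λ g h → among-map (difference≡⇔ g h) ⇔-∘ S≐ (h ∙ g ⁻¹)
    }

  module CayleyIso {S t₁ t₂ t₃} (S≐ : EnumeratedBy S t₁ t₂ t₃) (connected : Connected Cay⟨ S ⟩)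
                   {Y : Graph} (NY : NeighbourTriple Y) (c₀ : V Y)
                   (f : V Y → A) (f-injective : ∀ {c d} → f c ≡ f d → c ≡ d)
                   (f-nbr₁ : ∀ c → f (NeighbourTriple.nbr₁ NY c) ≡ f c ∙ t₁)
                   (f-nbr₂ : ∀ c → f (NeighbourTriple.nbr₂ NY c) ≡ f c ∙ t₂)
                   (f-nbr₃ : ∀ c → f (NeighbourTriple.nbr₃ NY c) ≡ f c ∙ t₃) where
    open NeighbourTriple NY

    lift : ∀ {u v} → Star (E Cay⟨ S ⟩) u v → ∃[ c ] f c ≡ u → ∃[ c ] f c ≡ v
    lift ε lifted = lifted
    lift {u} (e ◅ w) (c , refl)
      with Equivalence.to (NeighbourTriple.adjacent⇔ (cayleyNeighbours S≐) u _) e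
    ... | inj₁ refl        = lift w (nbr₁ c , f-nbr₁ c)
    ... | inj₂ (inj₁ refl) = lift w (nbr₂ c , f-nbr₂ c)
    ... | inj₂ (inj₂ refl) = lift w (nbr₃ c , f-nbr₃ c)

    f⁻¹ : A → V Y
    f⁻¹ v = proj₁ (lift (connected (f c₀) v) (c₀ , refl))

    f∘f⁻¹ : ∀ v → f (f⁻¹ v) ≡ v
    f∘f⁻¹ v = proj₂ (lift (connected (f c₀) v) (c₀ , refl))

    f⁻¹-shift : ∀ {u t} c → f c ≡ u ∙ t → f⁻¹ (u ∙ t) ≡ c
    f⁻¹-shift c fc≡u∙t = f-injective (trans (f∘f⁻¹ _) (sym fc≡u∙t))

    cayley≅ : Cay⟨ S ⟩ ≅ Y
    cayley≅ = ≅-via-neighbours (cayleyNeighbours S≐) NY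
      (mk↔ₛ′ f⁻¹ f (λ c → f-injective (f∘f⁻¹ (f c))) f∘f⁻¹)
      (λ u w → among-cong (f⁻¹-shift _ (along f-nbr₁)) (f⁻¹-shift _ (along f-nbr₂))
                          (f⁻¹-shift _ (along f-nbr₃)))
      where
      along : ∀ {u t} {n : V Y → V Y} → (∀ c → f (n c) ≡ f c ∙ t) → f (n (f⁻¹ u)) ≡ u ∙ t
      along {u} {t} f-n = trans (f-n _) (cong (_∙ t) (f∘f⁻¹ u))

  module FactorOf {S t₁ t₂ t₃} (S≐ : EnumeratedBy S t₁ t₂ t₃) (T : TwoFactor Cay⟨ S ⟩) where
    uses-others : ∀ g → ¬ F T g (g ∙ t₃) → F T g (g ∙ t₁) × F T g (g ∙ t₂)
    uses-others g = valency2-avoiding {R = F T} (val2 T g) λ c Fgc →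
      Equivalence.to (NeighbourTriple.adjacent⇔ (cayleyNeighbours S≐) g c) (sub T g c Fgc)

  ¬cyclable-K₄ : ∀ {S s₁ s₂} → EnumeratedBy S s₁ s₂ (s₁ ∙ s₂) → s₁ ∙ s₁ ≡ 0# → 0# ≢ s₁ →
                 ¬ TwoSpanningCyclable Cay⟨ S ⟩
  ¬cyclable-K₄ {S} {s₁} {s₂} S≐ s₁∙s₁≡0 0≢s₁ cyclable with cyclable 0# s₁ 0≢s₁
  ... | T , ¬0~s₁ , _ = ¬0~s₁ ((0—s₁∙s₂ ◅ ε) ◅◅ reverse (symF T _ _) (s₁—s₁∙s₂ ◅ ε))
    where
    open FactorOf (enumeratedBy-rotate S≐) T
    0—s₁∙s₂ : F T 0# (s₁ ∙ s₂)
    0—s₁∙s₂ = subst (F T 0#) (identityˡ _)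
      (proj₂ (uses-others 0# λ f → ¬0~s₁ (subst (F T 0#) (identityˡ s₁) f ◅ ε)))
    s₁—s₁∙s₂ : F T s₁ (s₁ ∙ s₂)
    s₁—s₁∙s₂ = proj₁ (uses-others s₁ λ f → ¬0~s₁ (reverse (symF T _ _) (subst (F T s₁) s₁∙s₁≡0 f ◅ ε)))

  ¬cyclable-triangularPrism : ∀ {S a b} → EnumeratedBy S a (a ⁻¹) b → a ∙ (a ∙ a) ≡ 0# → 0# ≢ a →
                              ¬ TwoSpanningCyclable Cay⟨ S ⟩
  ¬cyclable-triangularPrism {S} {a} S≐ a³≡0 0≢a cyclable with cyclable 0# a 0≢a
  ... | T , ¬0~a , _ = ¬0~a ((0—a⁻¹ ◅ ε) ◅◅ reverse (symF T _ _) (a—a⁻¹ ◅ ε))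
    where
    0—a⁻¹ : F T 0# (a ⁻¹)
    0—a⁻¹ = subst (F T 0#) (identityˡ _)
      (proj₁ (FactorOf.uses-others (enumeratedBy-rotate S≐) T 0# λ f →
                ¬0~a (subst (F T 0#) (identityˡ a) f ◅ ε)))
    a—a⁻¹ : F T a (a ⁻¹)
    a—a⁻¹ = subst (F T a) (inverseʳ-unique a (a ∙ a) a³≡0)
      (proj₂ (FactorOf.uses-others (enumeratedBy-rotate (enumeratedBy-rotate S≐)) T a λ f →
                ¬0~a (reverse (symF T _ _) (subst (F T a) (inverseʳ a) f ◅ ε))))

  ¬cyclable-möbius : ∀ {S a b} k → EnumeratedBy S a (a ⁻¹) b → b ∙ b ≡ 0# → b ≡ k · a → 0# ≢ b →
                     ¬ TwoSpanningCyclable Cay⟨ S ⟩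
  ¬cyclable-möbius {S} {a} {b} k S≐ b∙b≡0 b≡k·a 0≢b cyclable with cyclable 0# b 0≢b
  ... | T , ¬0~b , _ = ¬0~b (subst (Star (F T) 0#) (sym b≡k·a) (proj₁ (rails k)))
    where
    open FactorOf S≐ T
    -- As 0 and b lie on different cycles, no rung x — x ∙ b with x ∈ ⟨a⟩ is used, so the
    -- factor runs along both rails ⟨a⟩ and ⟨a⟩ ∙ b.
    rails : ∀ j → Star (F T) 0# (j · a) × Star (F T) b (j · a ∙ b)
    rails zero    = ε , subst (Star (F T) b) (sym (identityˡ b)) ε
    rails (suc j) = subst (Star (F T) 0#) (comm x a) (0~x ◅◅ (x—x∙a ◅ ε)) ,
                    subst (Star (F T) b) y∙a≡ (b~y ◅◅ (y—y∙a ◅ ε))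
      where
      x y : A
      x = j · a
      y = x ∙ b
      0~x : Star (F T) 0# x
      0~x = proj₁ (rails j)
      b~y : Star (F T) b y
      b~y = proj₂ (rails j)
      y∙b≡x : y ∙ b ≡ x
      y∙b≡x = trans (assoc x b b) (trans (cong (x ∙_) b∙b≡0) (identityʳ x))
      y∙a≡ : y ∙ a ≡ suc j · a ∙ b
      y∙a≡ = trans (assoc x b a) (trans (cong (x ∙_) (comm b a))
               (trans (sym (assoc x a b)) (cong (_∙ b) (comm x a))))
      x—x∙a : F T x (x ∙ a)
      x—x∙a = proj₁ (uses-others x λ f → ¬0~b (0~x ◅◅ (f ◅ reverse (symF T _ _) b~y)))
      y—y∙a : F T y (y ∙ a)
      y—y∙a = proj₁ (uses-others y λ f →
                ¬0~b (0~x ◅◅ reverse (symF T _ _) (b~y ◅◅ (subst (F T y) y∙b≡x f ◅ ε))))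

  shift-annihilates : ∀ {a} i d → i · a ≡ (i ℕ.+ d) · a → d · a ≡ 0#
  shift-annihilates {a} i d e =
    ∙-cancelˡ (i · a) (d · a) 0# (trans (sym (×-homo-+ a i d)) (trans (sym e) (sym (identityʳ _))))

  record HasOrder (a : A) (n : ℕ) : Set where
    field
      annihilates : n · a ≡ 0#
      minimal     : ∀ {k} → 0 < k → k < n → k · a ≢ 0#

    distinct-below : ∀ {x y} → x < y → y < n → x · a ≢ y · a
    distinct-below {x} {y} x<y y<n e = minimal (ℕ.m<n⇒0<n∸m x<y) (ℕ.≤-<-trans (ℕ.m∸n≤m y x) y<n)
      (shift-annihilates x (y ∸ x) (trans e (cong (_· a) (sym (ℕ.m+[n∸m]≡n (ℕ.<⇒≤ x<y))))))

    ·-injective : ∀ {x y} → x < n → y < n → x · a ≡ y · a → x ≡ y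
    ·-injective {x} {y} x<n y<n e with ℕ.<-cmp x y
    ... | tri< x<y _ _ = ⊥-elim (distinct-below x<y y<n e)
    ... | tri≈ _ x≡y _ = x≡y
    ... | tri> _ _ y<x = ⊥-elim (distinct-below y<x x<n (sym e))

    multiples-annihilate : ∀ q → (q * n) · a ≡ 0#
    multiples-annihilate zero    = refl
    multiples-annihilate (suc q) = trans (×-homo-+ a n (q * n))
      (trans (cong₂ _∙_ annihilates (multiples-annihilate q)) (identityˡ 0#))

    ·-mod : .{{_ : NonZero n}} → ∀ k → (k % n) · a ≡ k · a
    ·-mod k = sym (begin
      k · a                             ≡⟨ cong (_· a) (m≡m%n+[m/n]*n k n) ⟩
      (k % n ℕ.+ (k / n) * n) · a       ≡⟨ ×-homo-+ a (k % n) _ ⟩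
      (k % n) · a ∙ ((k / n) * n) · a   ≡⟨ cong ((k % n) · a ∙_) (multiples-annihilate (k / n)) ⟩
      (k % n) · a ∙ 0#                  ≡⟨ identityʳ _ ⟩
      (k % n) · a                       ∎)
      where open ≡-Reasoning

    ·-inverse : ∀ {y} → y ≤ n → (y · a) ⁻¹ ≡ (n ∸ y) · a
    ·-inverse {y} y≤n = sym (inverseʳ-unique (y · a) ((n ∸ y) · a)
      (trans (sym (×-homo-+ a y (n ∸ y))) (trans (cong (_· a) (ℕ.m+[n∸m]≡n y≤n)) annihilates)))

  module PrismEmbedding {S a b n} (S≐ : EnumeratedBy S a (a ⁻¹) b) (connected : Connected Cay⟨ S ⟩)
                        (a-order : HasOrder a (suc n)) (b∙b≡0 : b ∙ b ≡ 0#)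
                        (b∉⟨a⟩ : ∀ k → b ≢ k · a) where
    open Prism n
    open HasOrder a-order using (·-injective; ·-mod; ·-inverse)

    offset : Fin 2 → A
    offset zero       = 0#
    offset (suc zero) = b

    embed : Vertex → A
    embed (i , x) = offset i ∙ toℕ x · a

    embed-right : ∀ c → embed (right c) ≡ embed c ∙ a
    embed-right (i , x) = begin
      offset i ∙ toℕ (next x) · a          ≡⟨ cong (λ k → offset i ∙ k · a) (toℕ-next x) ⟩
      offset i ∙ (suc (toℕ x) % suc n) · a ≡⟨ cong (offset i ∙_) (·-mod (suc (toℕ x))) ⟩
      offset i ∙ (a ∙ toℕ x · a)           ≡⟨ cong (offset i ∙_) (comm a _) ⟩
      offset i ∙ (toℕ x · a ∙ a)           ≡⟨ assoc _ _ a ⟨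
      offset i ∙ toℕ x · a ∙ a             ∎
      where open ≡-Reasoning

    embed-left : ∀ c → embed (left c) ≡ embed c ∙ a ⁻¹
    embed-left c = sym (trans (cong (λ v → embed v ∙ a ⁻¹) (sym (right-left c)))
                              (trans (cong (_∙ a ⁻¹) (embed-right (left c))) (//-rightDividesʳ a _)))

    embed-across : ∀ c → embed (across c) ≡ embed c ∙ b
    embed-across (zero , x)     = trans (comm b _) (cong (_∙ b) (sym (identityˡ _)))
    embed-across (suc zero , x) = begin
      0# ∙ toℕ x · a         ≡⟨ identityˡ _ ⟩
      toℕ x · a              ≡⟨ identityʳ _ ⟨
      toℕ x · a ∙ 0#         ≡⟨ cong (toℕ x · a ∙_) b∙b≡0 ⟨
      toℕ x · a ∙ (b ∙ b)    ≡⟨ assoc _ b b ⟨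
      toℕ x · a ∙ b ∙ b      ≡⟨ cong (_∙ b) (comm _ b) ⟩
      b ∙ toℕ x · a ∙ b      ∎
      where open ≡-Reasoning

    layers-disjoint : ∀ (x y : Fin (suc n)) → toℕ x · a ≢ b ∙ toℕ y · a
    layers-disjoint x y e = b∉⟨a⟩ (toℕ x ℕ.+ (suc n ∸ toℕ y)) (begin
      b                               ≡⟨ Equivalence.from (difference≡⇔ _ _ b) (trans e (comm b _)) ⟨
      toℕ x · a ∙ (toℕ y · a) ⁻¹      ≡⟨ cong (toℕ x · a ∙_) (·-inverse (ℕ.<⇒≤ (toℕ<n y))) ⟩
      toℕ x · a ∙ (suc n ∸ toℕ y) · a ≡⟨ ×-homo-+ a (toℕ x) _ ⟨
      (toℕ x ℕ.+ (suc n ∸ toℕ y)) · a ∎)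
      where open ≡-Reasoning

    column-injective : ∀ {x y : Fin (suc n)} → toℕ x · a ≡ toℕ y · a → x ≡ y
    column-injective e = toℕ-injective (·-injective (toℕ<n _) (toℕ<n _) e)

    embed-injective : ∀ {c d} → embed c ≡ embed d → c ≡ d
    embed-injective {i , x} {j , y} e with i | j
    ... | zero     | zero     =
      cong (zero ,_) (column-injective (trans (sym (identityˡ _)) (trans e (identityˡ _))))
    ... | suc zero | suc zero = cong (suc zero ,_) (column-injective (∙-cancelˡ b _ _ e))
    ... | zero     | suc zero = ⊥-elim (layers-disjoint x y (trans (sym (identityˡ _)) e))
    ... | suc zero | zero     = ⊥-elim (layers-disjoint y x (trans (sym (identityˡ _)) (sym e)))

    prism≅ : Cay⟨ S ⟩ ≅ K₂□C (suc n)
    prism≅ = CayleyIso.cayley≅ S≐ connected prismNeighbours (zero , zero)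
               embed embed-injective embed-right embed-left embed-across

  involution-unique-inverse : ∀ {x y} → x ∙ x ≡ 0# → x ∙ y ≡ 0# → y ≡ x
  involution-unique-inverse {x} {y} x∙x≡0 x∙y≡0 =
    trans (inverseʳ-unique x y x∙y≡0) (sym (inverseʳ-unique x x x∙x≡0))

  enumerated-nonzero : ∀ {S t₁ t₂ t₃} → EnumeratedBy S t₁ t₂ t₃ → ¬ S 0# →
                       ∀ {s} → Among s t₁ t₂ t₃ → 0# ≢ s
  enumerated-nonzero S≐ ¬S0 s∈S refl = ¬S0 (Equivalence.from (S≐ 0#) s∈S)

  module CubeEmbedding {S s₁ s₂ s₃} (S≐ : EnumeratedBy S s₁ s₂ s₃) (connected : Connected Cay⟨ S ⟩)
                       (¬S0 : ¬ S 0#) (s₁≢s₂ : s₁ ≢ s₂) (s₁≢s₃ : s₁ ≢ s₃) (s₂≢s₃ : s₂ ≢ s₃)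
                       (s₁∙s₁≡0 : s₁ ∙ s₁ ≡ 0#) (s₂∙s₂≡0 : s₂ ∙ s₂ ≡ 0#) (s₃∙s₃≡0 : s₃ ∙ s₃ ≡ 0#)
                       (s₃≢s₁∙s₂ : s₃ ≢ s₁ ∙ s₂) where

    pick : Bool → A → A
    pick false _ = 0#
    pick true  s = s

    embed : Vec Bool 3 → A
    embed (x ∷ y ∷ z ∷ []) = pick x s₁ ∙ (pick y s₂ ∙ pick z s₃)

    pick-not : ∀ {s} → s ∙ s ≡ 0# → ∀ x → pick (not x) s ≡ pick x s ∙ s
    pick-not _     false = sym (identityˡ _)
    pick-not s∙s≡0 true  = sym s∙s≡0

    pick-xor : ∀ {s} → s ∙ s ≡ 0# → ∀ x y → pick (x xor y) s ≡ pick x s ∙ pick y s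
    pick-xor _     false y     = sym (identityˡ _)
    pick-xor _     true  false = sym (identityʳ _)
    pick-xor s∙s≡0 true  true  = sym s∙s≡0

    embed-toggle₁ : ∀ u → embed (toggle zero u) ≡ embed u ∙ s₁
    embed-toggle₁ (x ∷ y ∷ z ∷ []) =
      trans (cong (_∙ (pick y s₂ ∙ pick z s₃)) (pick-not s₁∙s₁≡0 x)) (xy∙z≈xz∙y (pick x s₁) s₁ _)

    embed-toggle₂ : ∀ u → embed (toggle (suc zero) u) ≡ embed u ∙ s₂
    embed-toggle₂ (x ∷ y ∷ z ∷ []) =
      trans (cong (λ w → pick x s₁ ∙ (w ∙ _)) (pick-not s₂∙s₂≡0 y))
            (trans (cong (pick x s₁ ∙_) (xy∙z≈xz∙y _ s₂ _)) (sym (assoc _ _ s₂)))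

    embed-toggle₃ : ∀ u → embed (toggle (suc (suc zero)) u) ≡ embed u ∙ s₃
    embed-toggle₃ (x ∷ y ∷ z ∷ []) =
      trans (cong (λ w → pick x s₁ ∙ (pick y s₂ ∙ w)) (pick-not s₃∙s₃≡0 z))
            (trans (cong (pick x s₁ ∙_) (sym (assoc _ _ s₃))) (sym (assoc _ _ s₃)))

    _⊕_ : Vec Bool 3 → Vec Bool 3 → Vec Bool 3
    _⊕_ = zipWith _xor_

    embed-⊕ : ∀ u v → embed (u ⊕ v) ≡ embed u ∙ embed v
    embed-⊕ (x ∷ y ∷ z ∷ []) (x′ ∷ y′ ∷ z′ ∷ []) =
      trans (cong₂ _∙_ (pick-xor s₁∙s₁≡0 x x′)
                       (cong₂ _∙_ (pick-xor s₂∙s₂≡0 y y′) (pick-xor s₃∙s₃≡0 z z′)))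
            (trans (cong (pick x s₁ ∙ pick x′ s₁ ∙_) (interchange _ _ _ _)) (interchange _ _ _ _))

    nonzero : ∀ {s} → Among s s₁ s₂ s₃ → s ≢ 0#
    nonzero s∈S e = enumerated-nonzero S≐ ¬S0 s∈S (sym e)

    embed-kernel : ∀ d → embed d ≡ 0# → d ≡ false ∷ false ∷ false ∷ []
    embed-kernel (false ∷ false ∷ false ∷ []) _ = refl
    embed-kernel (true  ∷ false ∷ false ∷ []) e =
      ⊥-elim (nonzero (inj₁ refl)
        (trans (sym (identityʳ s₁)) (trans (cong (s₁ ∙_) (sym (identityˡ 0#))) e)))
    embed-kernel (false ∷ true  ∷ false ∷ []) e =
      ⊥-elim (nonzero (inj₂ (inj₁ refl)) (trans (sym (identityʳ s₂)) (trans (sym (identityˡ _)) e)))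
    embed-kernel (false ∷ false ∷ true  ∷ []) e =
      ⊥-elim (nonzero (inj₂ (inj₂ refl)) (trans (sym (identityˡ s₃)) (trans (sym (identityˡ _)) e)))
    embed-kernel (true  ∷ true  ∷ false ∷ []) e =
      ⊥-elim (s₁≢s₂ (sym (involution-unique-inverse s₁∙s₁≡0
        (trans (cong (s₁ ∙_) (sym (identityʳ s₂))) e))))
    embed-kernel (true  ∷ false ∷ true  ∷ []) e =
      ⊥-elim (s₁≢s₃ (sym (involution-unique-inverse s₁∙s₁≡0
        (trans (cong (s₁ ∙_) (sym (identityˡ s₃))) e))))
    embed-kernel (false ∷ true  ∷ true  ∷ []) e =
      ⊥-elim (s₂≢s₃ (sym (involution-unique-inverse s₂∙s₂≡0 (trans (sym (identityˡ _)) e))))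
    embed-kernel (true  ∷ true  ∷ true  ∷ []) e =
      ⊥-elim (s₃≢s₁∙s₂ (involution-unique-inverse s₁∙s₂-involution (trans (assoc s₁ s₂ s₃) e)))
      where
      s₁∙s₂-involution : (s₁ ∙ s₂) ∙ (s₁ ∙ s₂) ≡ 0#
      s₁∙s₂-involution =
        trans (interchange s₁ s₂ s₁ s₂) (trans (cong₂ _∙_ s₁∙s₁≡0 s₂∙s₂≡0) (identityˡ 0#))

    embed-self : ∀ u → embed (u ⊕ u) ≡ 0#
    embed-self (x ∷ y ∷ z ∷ []) rewrite xor-same x | xor-same y | xor-same z =
      trans (identityˡ _) (identityˡ _)

    embed-injective : ∀ {u v} → embed u ≡ embed v → u ≡ v
    embed-injective {u} {v} e = xor≡false⇒≡ u v (embed-kernel (u ⊕ v) (begin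
      embed (u ⊕ v)       ≡⟨ embed-⊕ u v ⟩
      embed u ∙ embed v   ≡⟨ cong (_∙ embed v) e ⟩
      embed v ∙ embed v   ≡⟨ embed-⊕ v v ⟨
      embed (v ⊕ v)       ≡⟨ embed-self v ⟩
      0#                  ∎))
      where open ≡-Reasoning

    cube≅ : Cay⟨ S ⟩ ≅ Q₃
    cube≅ = CayleyIso.cayley≅ S≐ connected cubeNeighbours (false ∷ false ∷ false ∷ [])
              embed embed-injective embed-toggle₁ embed-toggle₂ embed-toggle₃

  InverseClosed : (A → Set) → Set
  InverseClosed S = ∀ x → S x → S (x ⁻¹)

  enumeratedBy-swap₂₃ : ∀ {S t₁ t₂ t₃} → EnumeratedBy S t₁ t₂ t₃ → EnumeratedBy S t₁ t₃ t₂
  enumeratedBy-swap₂₃ S≐ x = among-swap ⇔-∘ (among-rotate ⇔-∘ (among-rotate ⇔-∘ S≐ x))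

  ⁻¹-swap : ∀ {x y} → x ⁻¹ ≡ y → y ⁻¹ ≡ x
  ⁻¹-swap {x} refl = ⁻¹-involutive x

  self-inverse⇒involution : ∀ {x} → x ⁻¹ ≡ x → x ∙ x ≡ 0#
  self-inverse⇒involution {x} x⁻¹≡x = trans (cong (x ∙_) (sym x⁻¹≡x)) (inverseʳ x)

  inverse-enumerated : ∀ {S s₁ s₂ s₃} → EnumeratedBy S s₁ s₂ s₃ → InverseClosed S →
                       ∀ {s} → Among s s₁ s₂ s₃ → Among (s ⁻¹) s₁ s₂ s₃
  inverse-enumerated S≐ closed {s} s∈S =
    Equivalence.to (S≐ _) (closed s (Equivalence.from (S≐ s) s∈S))

  third-involution : ∀ {S s₁ s₂ s₃} → EnumeratedBy S s₁ s₂ s₃ → InverseClosed S →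
                     s₁ ⁻¹ ≢ s₃ → s₂ ⁻¹ ≢ s₃ → s₃ ∙ s₃ ≡ 0#
  third-involution {s₃ = s₃} S≐ closed s₁⁻¹≢s₃ s₂⁻¹≢s₃
    with inverse-enumerated S≐ closed (inj₂ (inj₂ refl))
  ... | inj₁ s₃⁻¹≡s₁        = ⊥-elim (s₁⁻¹≢s₃ (⁻¹-swap s₃⁻¹≡s₁))
  ... | inj₂ (inj₁ s₃⁻¹≡s₂) = ⊥-elim (s₂⁻¹≢s₃ (⁻¹-swap s₃⁻¹≡s₂))
  ... | inj₂ (inj₂ s₃⁻¹≡s₃) = self-inverse⇒involution s₃⁻¹≡s₃

  classify : ∀ {S s₁ s₂ s₃} → EnumeratedBy S s₁ s₂ s₃ → Distinct₃ s₁ s₂ s₃ → InverseClosed S →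
             (s₁ ∙ s₁ ≡ 0# × s₂ ∙ s₂ ≡ 0# × s₃ ∙ s₃ ≡ 0#) ⊎
             (∃[ a ] ∃[ b ] (EnumeratedBy S a (a ⁻¹) b × a ≢ a ⁻¹ × b ∙ b ≡ 0#))
  classify {S} {s₁} {s₂} {s₃} S≐ (s₁≢s₂ , s₁≢s₃ , s₂≢s₃) closed
    with inverse-enumerated S≐ closed (inj₁ refl)
  ... | inj₂ (inj₁ s₁⁻¹≡s₂) = inj₂ (s₁ , s₃ ,
          subst (λ t → EnumeratedBy S s₁ t s₃) (sym s₁⁻¹≡s₂) S≐ , (λ e → s₁≢s₂ (trans e s₁⁻¹≡s₂)) ,
          third-involution S≐ closed (λ e → s₂≢s₃ (trans (sym s₁⁻¹≡s₂) e))
                                     (λ e → s₁≢s₃ (trans (sym (⁻¹-swap s₁⁻¹≡s₂)) e)))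
  ... | inj₂ (inj₂ s₁⁻¹≡s₃) = inj₂ (s₁ , s₂ ,
          subst (λ t → EnumeratedBy S s₁ t s₂) (sym s₁⁻¹≡s₃) (enumeratedBy-swap₂₃ S≐) ,
          (λ e → s₁≢s₃ (trans e s₁⁻¹≡s₃)) ,
          third-involution (enumeratedBy-swap₂₃ S≐) closed (λ e → s₂≢s₃ (sym (trans (sym s₁⁻¹≡s₃) e)))
                                      (λ e → s₁≢s₂ (trans (sym (⁻¹-swap s₁⁻¹≡s₃)) e)))
  ... | inj₁ s₁⁻¹≡s₁ with inverse-enumerated S≐ closed (inj₂ (inj₁ refl))
  ...   | inj₁ s₂⁻¹≡s₁ = ⊥-elim (s₁≢s₂ (trans (sym s₁⁻¹≡s₁) (⁻¹-swap s₂⁻¹≡s₁)))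
  ...   | inj₂ (inj₁ s₂⁻¹≡s₂) = inj₁ (self-inverse⇒involution s₁⁻¹≡s₁ , self-inverse⇒involution s₂⁻¹≡s₂ ,
          third-involution S≐ closed (λ e → s₁≢s₃ (trans (sym s₁⁻¹≡s₁) e))
                                     (λ e → s₂≢s₃ (trans (sym s₂⁻¹≡s₂) e)))
  ...   | inj₂ (inj₂ s₂⁻¹≡s₃) = inj₂ (s₂ , s₁ ,
          subst (λ t → EnumeratedBy S s₂ t s₁) (sym s₂⁻¹≡s₃) (enumeratedBy-rotate S≐) ,
          (λ e → s₂≢s₃ (trans e s₂⁻¹≡s₃)) , self-inverse⇒involution s₁⁻¹≡s₁)

  module Finite {m} (A↔Fin : A ↔ Fin m) where

    infix 4 _≟_
    _≟_ : DecidableEquality A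
    _≟_ = via-injection (↔⇒↣ A↔Fin) Data.Fin._≟_

    periodic : ∀ a → ∃[ d ] suc d · a ≡ 0#
    periodic a with pigeonhole (ℕ.n<1+n m) (λ k → Inverse.to A↔Fin (toℕ k · a))
    ... | i , j , i<j , same with toℕ j ∸ toℕ i in d≡ | ℕ.m<n⇒0<n∸m i<j
    ...   | suc d | _ = d , subst (λ k → k · a ≡ 0#) d≡
      (shift-annihilates (toℕ i) (toℕ j ∸ toℕ i)
        (trans (Injection.injective (↔⇒↣ A↔Fin) same) (cong (_· a) (sym (ℕ.m+[n∸m]≡n (ℕ.<⇒≤ i<j))))))

    order : ∀ a → ∃[ n ] HasOrder a (suc n)
    order a with periodic a
    ... | d , annihilates-d
      with ¬∀⟶∃¬-smallest (suc d) (λ i → suc (toℕ i) · a ≢ 0#) (λ i → ¬? (suc (toℕ i) · a ≟ 0#))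
             (λ nonzero → nonzero (fromℕ d)
                (subst (λ k → suc k · a ≡ 0#) (sym (toℕ-fromℕ d)) annihilates-d))
    ... | i , ¬¬annihilates , below = toℕ i , record
      { annihilates = decidable-stable (suc (toℕ i) · a ≟ 0#) ¬¬annihilates
      ; minimal     = minimal
      }
      where
      minimal : ∀ {k} → 0 < k → k < suc (toℕ i) → k · a ≢ 0#
      minimal {suc k} _ (s≤s k<i) =
        subst (λ l → suc l · a ≢ 0#) (trans (toℕ-inject j) (toℕ-fromℕ< k<i)) (below j)
        where
        j = fromℕ< k<i

    cube-case : ∀ {S s₁ s₂ s₃} → EnumeratedBy S s₁ s₂ s₃ → Distinct₃ s₁ s₂ s₃ → ¬ S 0# →
                Connected Cay⟨ S ⟩ → s₁ ∙ s₁ ≡ 0# → s₂ ∙ s₂ ≡ 0# → s₃ ∙ s₃ ≡ 0# →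
                TwoSpanningCyclable Cay⟨ S ⟩ → Cay⟨ S ⟩ ≅ Q₃
    cube-case {s₁ = s₁} {s₂} {s₃} S≐ (s₁≢s₂ , s₁≢s₃ , s₂≢s₃) ¬S0 connected s₁² s₂² s₃² cyclable
      with s₃ ≟ s₁ ∙ s₂
    ... | yes refl     = ⊥-elim (¬cyclable-K₄ S≐ s₁² (enumerated-nonzero S≐ ¬S0 (inj₁ refl)) cyclable)
    ... | no s₃≢s₁∙s₂ = CubeEmbedding.cube≅ S≐ connected ¬S0 s₁≢s₂ s₁≢s₃ s₂≢s₃ s₁² s₂² s₃² s₃≢s₁∙s₂

    prism-case : ∀ {S a b} → EnumeratedBy S a (a ⁻¹) b → a ≢ a ⁻¹ → b ∙ b ≡ 0# → ¬ S 0# →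
                 Connected Cay⟨ S ⟩ → TwoSpanningCyclable Cay⟨ S ⟩ →
                 ∃[ n ] (4 ≤ n × Cay⟨ S ⟩ ≅ K₂□C n)
    prism-case {S} {a} {b} S≐ a≢a⁻¹ b∙b≡0 ¬S0 connected cyclable with order a
    ... | n , a-order with any? (λ (k : Fin (suc n)) → b ≟ toℕ k · a)
    ...   | yes (k , b≡k·a) =
      ⊥-elim (¬cyclable-möbius (toℕ k) S≐ b∙b≡0 b≡k·a
                (enumerated-nonzero S≐ ¬S0 (inj₂ (inj₂ refl))) cyclable)
    ...   | no b∉ = by-order n a-order
      where
      b∉⟨a⟩ : ∀ k → b ≢ k · a
      b∉⟨a⟩ k e = b∉ (fromℕ< (m%n<n k (suc n)) ,
        trans e (sym (trans (cong (_· a) (toℕ-fromℕ< (m%n<n k (suc n)))) (HasOrder.·-mod a-order k))))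
      by-order : ∀ n → HasOrder a (suc n) → ∃[ n ] (4 ≤ n × Cay⟨ S ⟩ ≅ K₂□C n)
      by-order zero a-order = ⊥-elim (enumerated-nonzero S≐ ¬S0 (inj₁ refl)
        (sym (trans (sym (identityʳ a)) (HasOrder.annihilates a-order))))
      by-order (suc zero) a-order = ⊥-elim (a≢a⁻¹ (inverseʳ-unique a a
        (trans (cong (a ∙_) (sym (identityʳ a))) (HasOrder.annihilates a-order))))
      by-order (suc (suc zero)) a-order = ⊥-elim (¬cyclable-triangularPrism S≐
        (trans (cong (λ x → a ∙ (a ∙ x)) (sym (identityʳ a))) (HasOrder.annihilates a-order))
        (enumerated-nonzero S≐ ¬S0 (inj₁ refl)) cyclable)
      by-order (suc (suc (suc m))) a-order =
        4 ℕ.+ m , s≤s (s≤s (s≤s (s≤s z≤n))) , PrismEmbedding.prism≅ S≐ connected a-order b∙b≡0 b∉⟨a⟩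

    cyclable⇒cube-or-prism : ∀ {S s₁ s₂ s₃} → EnumeratedBy S s₁ s₂ s₃ → Distinct₃ s₁ s₂ s₃ → ¬ S 0# →
                             InverseClosed S → Connected Cay⟨ S ⟩ →
                             TwoSpanningCyclable Cay⟨ S ⟩ →
                             Cay⟨ S ⟩ ≅ Q₃ ⊎ ∃[ n ] (4 ≤ n × Cay⟨ S ⟩ ≅ K₂□C n)
    cyclable⇒cube-or-prism S≐ distinct ¬S0 closed connected cyclable with classify S≐ distinct closed
    ... | inj₁ (s₁² , s₂² , s₃²) = inj₁ (cube-case S≐ distinct ¬S0 connected s₁² s₂² s₃² cyclable)
    ... | inj₂ (a , b , S≐′ , a≢a⁻¹ , b∙b≡0) = inj₂ (prism-case S≐′ a≢a⁻¹ b∙b≡0 ¬S0 connected cyclable)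

cube-or-prism⇒cyclable : ∀ {X} → X ≅ Q₃ ⊎ ∃[ n ] (4 ≤ n × X ≅ K₂□C n) → TwoSpanningCyclable X
cube-or-prism⇒cyclable (inj₁ X≅Q₃) = Pullback.pullbackCyclable X≅Q₃ Q₃-cyclable
cube-or-prism⇒cyclable (inj₂ (suc (suc (suc (suc m))) , s≤s (s≤s (s≤s (s≤s z≤n))) , X≅prism)) =
  Pullback.pullbackCyclable X≅prism (Square.prism-cyclable m)

mainTheorem1 :
    (A : Set) (_+_ : Op₂ A) (0# : A) (-_ : Op₁ A) →
    IsAbelianGroup _≡_ _+_ 0# -_ →
    (∃[ m ] (A ↔ Fin m)) →
    (S : A → Set) →
    ¬ S 0# →
    (∀ x → S x → S (- x)) →
    HasSize3 S →
    Connected (Cay A _+_ -_ S) →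
    (TwoSpanningCyclable (Cay A _+_ -_ S) ⇔
      (Cay A _+_ -_ S ≅ Q₃ ⊎ (∃[ n ] (4 ≤ n × Cay A _+_ -_ S ≅ K₂□C n))))
mainTheorem1 A _+_ 0# -_ isAbelianGroup (_ , A↔Fin) S ¬S0 closed
             (s₁ , s₂ , s₃ , s₁≢s₂ , s₁≢s₃ , s₂≢s₃ , S≐) connected =
  mk⇔ (cyclable⇒cube-or-prism S≐ (s₁≢s₂ , s₁≢s₃ , s₂≢s₃) ¬S0 closed connected)
      cube-or-prism⇒cyclable
  where
  open Cayley A _+_ 0# -_ isAbelianGroup
  open Finite A↔Fin
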